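{- Let $t\ge 1$ and for $i=1,\dots,t$ let $C_{k_i}^{p_i}$ be an oriented cycle on $k_i$ vertices with $p_i$ sources and $p_i$ sinks. The direct product $C_{k_1}^{p_1}\times\cdots\times C_{k_t}^{p_t}$ is an ECD digraph if and only if at most one of $p_1,\dots,p_t$ is nonzero and, moreover: (i) if $p_1=\cdots=p_t=0$, then at least one of $k_1,\ldots,k_t$ is even; (ii) if $p_j>0$ for some (necessarily unique) $j$, then in $C_{k_j}^{p_j}$ every sink is at even distance to at least one of its neighboring sources.
   Context: A digraph's vertex $v$ is a source if it has in-degree $0$ and a sink if it has out-degree $0$. An oriented cycle $C_k^p$ is a cycle on $k$ vertices each of whose edges is given one orientation, having $p$ sources and $p$ sinks; $C_k^0$ is the directed cycle. In an oriented cycle, a source $v$ is a neighboring source of a vertex $u$ if there is a directed path from $v$ to $u$ (containing no sink except possibly $u$); the distance between a vertex and a neighboring source is the length of that path (which contains no other sources or sinks). The direct product $D\times F$ has vertex set $V(D)\times V(F)$ and an arc from $(d,f)$ to $(d',f')$ iff $(d,d')\in A(D)$ and $(f,f')\in A(F)$. With $N^+_D[v]=\{v\}\cup\{u:(v,u)\in A(D)\}$, a set $S$ is an ECD set of $D$ if $\{N^+_D[v]:v\in S\}$ is a partition of $V(D)$, and $D$ is an ECD digraph if it has an ECD set. -}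

module Defs where

open import Data.Nat using (ℕ; zero; suc; _+_)
open import Data.Nat.Divisibility using (_∣_)
open import Data.Nat.DivMod using (_mod_)
open import Data.Bool using (Bool; true; false)
import Data.Bool.Properties as BoolP
open import Data.Fin using (Fin; toℕ)
import Data.Fin.Properties as FinP
open import Data.Product using (Σ; _×_; _,_; ∃; ∃-syntax)
open import Data.Sum using (_⊎_; inj₁; inj₂)
open import Data.Vec using (Vec; _∷_; []; lookup)
open import Data.List using (List; length; filter)
open import Data.List.Base using () renaming (tabulate to ltabulate)
open import Relation.Binary.PropositionalEquality using (_≡_; _≢_)
open import Relation.Nullary using (¬_; Dec)
open import Relation.Nullary.Decidable using (_×-dec_; _⊎-dec_; ¬?)

record Digraph : Set₁ where
  field
    V   : Set
    Arc : V → V → Set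
open Digraph public

N⁺[_]∋_ : (D : Digraph) → V D → V D → Set
N⁺[ D ]∋ s = λ v → (v ≡ s) ⊎ Arc D s v

IsECDSet : (D : Digraph) → (V D → Bool) → Set
IsECDSet D S =
  ((v : V D) → ∃[ s ] (S s ≡ true × (N⁺[ D ]∋ s) v)) ×
  ((v s s' : V D) → S s ≡ true → (N⁺[ D ]∋ s) v →
                    S s' ≡ true → (N⁺[ D ]∋ s') v → s ≡ s')

IsECD : Digraph → Set
IsECD D = Σ (V D → Bool) (IsECDSet D)

IsSource : (D : Digraph) → V D → Set
IsSource D v = (u : V D) → ¬ Arc D u v

IsSink : (D : Digraph) → V D → Set
IsSink D v = (u : V D) → ¬ Arc D v u

_⊗_ : Digraph → Digraph → Digraph
D ⊗ F = record
  { V   = V D × V F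
  ; Arc = λ { (d , f) (d' , f') → Arc D d d' × Arc F f f' } }

-- Oriented cycles.  A cycle on k = 3 + n vertices 0,…,k-1; edge i joins
-- vertex i and vertex i+1 (mod k); it is oriented i → i+1 when
-- orient i ≡ true and i+1 → i when orient i ≡ false.

record OCycle : Set where
  field
    n      : ℕ
    orient : Fin (3 + n) → Bool
open OCycle public

len : OCycle → ℕ
len c = 3 + n c

next : (c : OCycle) → Fin (len c) → Fin (len c)
next c i = suc (toℕ i) mod (3 + n c)

CArc : (c : OCycle) → Fin (len c) → Fin (len c) → Set
CArc c u v = (v ≡ next c u × orient c u ≡ true) ⊎ (u ≡ next c v × orient c v ≡ false)

asDigraph : OCycle → Digraph
asDigraph c = record { V = Fin (len c) ; Arc = CArc c }

CArc? : (c : OCycle) → (u v : Fin (len c)) → Dec (CArc c u v)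
CArc? c u v = (v FinP.≟ next c u ×-dec orient c u BoolP.≟ true)
         ⊎-dec (u FinP.≟ next c v ×-dec orient c v BoolP.≟ false)

IsSource? : (c : OCycle) → (v : Fin (len c)) → Dec (IsSource (asDigraph c) v)
IsSource? c v = FinP.all? (λ u → ¬? (CArc? c u v))

-- p = the number of sources of the oriented cycle (= number of sinks)
p : OCycle → ℕ
p c = length (filter (IsSource? c) (ltabulate {n = len c} (λ i → i)))

data SinkFreePath (D : Digraph) : V D → V D → ℕ → Set where
  stop : ∀ {u} → SinkFreePath D u u zero
  step : ∀ {x y u d} → ¬ IsSink D x → Arc D x y →
         SinkFreePath D y u d → SinkFreePath D x u (suc d)

NeighSourceAt : (D : Digraph) → V D → V D → ℕ → Set
NeighSourceAt D u v d = IsSource D v × SinkFreePath D v u d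

SinksEvenToSource : OCycle → Set
SinksEvenToSource c = (u : Fin (len c)) → IsSink D u →
  ∃[ v ] ∃[ d ] (NeighSourceAt D u v d × 2 ∣ d)
  where D = asDigraph c

-- product C₁ × ⋯ × C_t of a nonempty family (t = suc m ≥ 1)

prodCycles : ∀ {m} → Vec OCycle (suc m) → Digraph
prodCycles (c ∷ []) = asDigraph c
prodCycles (c ∷ c' ∷ cs) = asDigraph c ⊗ prodCycles (c' ∷ cs)

module Submission where

-- If two factors have sources, a source s of one and a vertex y with two distinct in-neighbours
-- x₁, x₂ in another (the cycle turns from forward to backward somewhere after s) give two sources
-- (s , x₁), (s , x₂) with a common out-neighbour, which no ECD set can accommodate.
-- If no factor has a source, every factor is a directed cycle and the product is the functional
-- digraph of a fixed-point-free permutation. An ECD set of such a digraph is exactly a set that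
-- alternates along the permutation, so it exists iff all orbits can be 2-coloured: an even factor
-- gives the colouring, while odd lengths give an odd common period.
-- If exactly one factor C has sources, the projection onto C is a discrete fibration (every arc
-- into the image of y lifts uniquely to an arc into y), so ECD sets of C pull back to the product.
-- Conversely, along a sink-free path from a source the membership of the fibres in an ECD set
-- alternates, so two in-neighbours of a sink at even distance would both be in the set and both
-- cover the sink; this is the sink condition. Under that condition the non-sinks at even distance
-- from their source, together with the sinks both of whose in-neighbours are at odd distance, form
-- an ECD set of C.

open import Defs
open import Data.Bool using (Bool; true; false; not; _∨_; if_then_else_)
open import Data.Bool.Properties using (not-involutive; not-injective; not-¬; ¬-not) renaming (_≟_ to _≟ᵇ_)
open import Data.Empty using (⊥; ⊥-elim)
open import Data.Fin using (Fin; toℕ) renaming (zero to fzero; suc to fsuc)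
import Data.Fin.Properties as Fin
open import Data.List using (length)
open import Data.List.Membership.Propositional using (lose)
open import Data.List.Membership.Propositional.Properties using (∈-tabulate⁺)
open import Data.List.Properties using (filter-some; filter-none)
import Data.List.Relation.Unary.All.Properties as All
open import Data.Nat using (ℕ; zero; suc; _+_; _*_; _∸_; _≤_; _<_; _%_; NonZero; _<?_; z≤n; s≤s; z<s)
open import Data.Nat.DivMod
  using (_mod_; %-distribˡ-+; m%n%n≡m%n; [m+n]%n≡m%n; m<n⇒m%n≡m; m≤n⇒[n∸m]%m≡n%m; n%n≡0)
open import Data.Nat.Divisibility using (_∣_; divides; _∣?_; ∣-refl; ∣m∣n⇒∣m+n)
open import Data.Nat.GeneralisedArithmetic using (fold; fold-+)
open import Data.Nat.Primality using (euclidsLemma; prime[2])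
open import Data.Nat.Properties
open import Data.Product using (∃; ∃-syntax; _×_; _,_; proj₁; proj₂; map; uncurry)
open import Data.Sum using (_⊎_; inj₁; inj₂; [_,_])
open import Data.Vec using (Vec; lookup; _∷_; [])
open import Function.Base using (id; _∘_)
open import Function.Bundles using (_⇔_; mk⇔)
open import Relation.Binary.PropositionalEquality hiding ([_])
open import Relation.Nullary using (¬_; Dec; yes; no; does; ¬?)
open import Relation.Nullary.Decidable using (decidable-stable)

private variable
  G H D : Digraph

-- Arithmetic, parity and iteration

[m+j]%n≢m : ∀ m j n .{{_ : NonZero n}} → m < n → 0 < j → j < n → (m + j) % n ≢ m
[m+j]%n≢m m j n m<n 0<j j<n eq with m + j <? n
... | yes m+j<n = <⇒≢ (m<m+n m 0<j) (sym (trans (sym (m<n⇒m%n≡m m+j<n)) eq))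
... | no  m+j≮n = <⇒≢ j<n j≡n
  where
    n≤m+j : n ≤ m + j
    n≤m+j = ≮⇒≥ m+j≮n
    m+j∸n<n : m + j ∸ n < n
    m+j∸n<n = +-cancelʳ-< _ _ n (subst (_< n + n) (sym (m∸n+n≡m n≤m+j)) (+-mono-< m<n j<n))
    m+j∸n≡m : m + j ∸ n ≡ m
    m+j∸n≡m = trans (sym (m<n⇒m%n≡m m+j∸n<n)) (trans (m≤n⇒[n∸m]%m≡n%m n≤m+j) eq)
    j≡n : j ≡ n
    j≡n = +-cancelˡ-≡ m j n (trans (sym (m∸n+n≡m n≤m+j)) (cong (_+ n) m+j∸n≡m))

[m%n+k]%n≡[m+k]%n : ∀ m k n .{{_ : NonZero n}} → (m % n + k) % n ≡ (m + k) % n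
[m%n+k]%n≡[m+k]%n m k n = begin
  (m % n + k) % n         ≡⟨ %-distribˡ-+ (m % n) k n ⟩
  (m % n % n + k % n) % n ≡⟨ cong (λ z → (z + k % n) % n) (m%n%n≡m%n m n) ⟩
  (m % n + k % n) % n     ≡⟨ %-distribˡ-+ m k n ⟨
  (m + k) % n             ∎
  where open ≡-Reasoning

isEven : ℕ → Bool
isEven zero    = true
isEven (suc n) = not (isEven n)

≡true⇒not≢true : ∀ {b} → b ≡ true → not b ≢ true
≡true⇒not≢true refl ()

≡true⇒not-∨≢trueˡ : ∀ {a b} → a ≡ true → not (a ∨ b) ≢ true
≡true⇒not-∨≢trueˡ refl ()

≡true⇒not-∨≢trueʳ : ∀ {a b} → b ≡ true → not (a ∨ b) ≢ true
≡true⇒not-∨≢trueʳ {true}  refl ()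
≡true⇒not-∨≢trueʳ {false} refl ()

isEven⇒2∣ : ∀ n → isEven n ≡ true → 2 ∣ n
isEven⇒2∣ zero          _ = divides 0 refl
isEven⇒2∣ (suc (suc n)) e = ∣m∣n⇒∣m+n ∣-refl (isEven⇒2∣ n (trans (sym (not-involutive _)) e))

2∣⇒isEven : ∀ {n} → 2 ∣ n → isEven n ≡ true
2∣⇒isEven (divides q refl) = even-multiple q
  where
    even-multiple : ∀ q → isEven (q * 2) ≡ true
    even-multiple zero    = refl
    even-multiple (suc q) = trans (not-involutive _) (even-multiple q)

fold-not-fixed⇒2∣ : ∀ n {b} → fold b not n ≡ b → 2 ∣ n
fold-not-fixed⇒2∣ zero          _ = divides 0 refl
fold-not-fixed⇒2∣ (suc zero)    e = ⊥-elim (not-¬ refl (sym e))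
fold-not-fixed⇒2∣ (suc (suc n)) e =
  ∣m∣n⇒∣m+n ∣-refl (fold-not-fixed⇒2∣ n (trans (sym (not-involutive _)) e))

IsPeriod : {A : Set} → (A → A) → ℕ → Set
IsPeriod f N = ∀ x → fold x f N ≡ x

isPeriod-* : ∀ {A : Set} {f : A → A} {N} → IsPeriod f N → ∀ M → IsPeriod f (M * N)
isPeriod-* per zero    x = refl
isPeriod-* {f = f} {N} per (suc M) x = begin
  fold x f (N + M * N)        ≡⟨ fold-+ x f N ⟩
  fold (fold x f (M * N)) f N ≡⟨ cong (λ z → fold z f N) (isPeriod-* per M x) ⟩
  fold x f N                  ≡⟨ per x ⟩
  x                           ∎
  where open ≡-Reasoning

fold-map : ∀ {A B : Set} (f : A → A) (g : B → B) x y n →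
  fold (x , y) (map f g) n ≡ (fold x f n , fold y g n)
fold-map f g x y zero    = refl
fold-map f g x y (suc n) = cong (map f g) (fold-map f g x y n)

fold-suc : ∀ {A : Set} (g : A → A) y j → fold y g (suc j) ≡ fold (g y) g j
fold-suc g y j = trans (cong (fold y g) (+-comm 1 j)) (fold-+ y g j)

fold-cancel : ∀ {A : Set} {g h : A → A} → (∀ y → g (h y) ≡ y) → ∀ j x → fold (fold x h j) g j ≡ x
fold-cancel gh zero    x = refl
fold-cancel {g = g} {h} gh (suc j) x = begin
  fold (h (fold x h j)) g (suc j)    ≡⟨ fold-suc g _ j ⟩
  fold (g (h (fold x h j))) g j      ≡⟨ cong (λ y → fold y g j) (gh _) ⟩
  fold (fold x h j) g j              ≡⟨ fold-cancel gh j x ⟩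
  x                                  ∎
  where open ≡-Reasoning

isPeriod-inverse : ∀ {A : Set} {g h : A → A} {N} → (∀ y → g (h y) ≡ y) → IsPeriod g N → IsPeriod h N
isPeriod-inverse {h = h} {N} gh per x = trans (sym (per (fold x h N))) (fold-cancel gh N x)

odd-* : ∀ {m n} → ¬ 2 ∣ m → ¬ 2 ∣ n → ¬ 2 ∣ m * n
odd-* {m} {n} m-odd n-odd 2∣mn = [ m-odd , n-odd ] (euclidsLemma m n prime[2] 2∣mn)

-- Paths, sources and ECD sets in an arbitrary digraph

arc⇒¬sink : ∀ {u v} → Arc D u v → ¬ IsSink D u
arc⇒¬sink u→v u-sink = u-sink _ u→v

snoc : ∀ {w u v d} → SinkFreePath D w u d → ¬ IsSink D u → Arc D u v → SinkFreePath D w v (suc d)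
snoc stop                u-live u→v = step u-live u→v stop
snoc (step x-live x→y p) u-live u→v = step x-live x→y (snoc p u-live u→v)

unsnoc : ∀ {w v d} → SinkFreePath D w v (suc d) →
  ∃[ u ] (SinkFreePath D w u d × ¬ IsSink D u × Arc D u v)
unsnoc (step w-live w→v stop) = _ , stop , w-live , w→v
unsnoc (step w-live w→y p@(step _ _ _)) with unsnoc p
... | u , q , u-live , u→v = u , step w-live w→y q , u-live , u→v

ECDSet-flip : ∀ {S z y} → IsECDSet D S → Arc D z y → z ≢ y →
  (∀ {z′} → Arc D z′ y → z′ ≡ z) → S y ≡ not (S z)
ECDSet-flip {S = S} {z} {y} (covers , unique) z→y z≢y only-z with S z in z∈S
... | true  = ¬-not λ y∈S → z≢y (unique y z y z∈S (inj₂ z→y) y∈S (inj₁ refl))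
... | false with covers y
...   | s , s∈S , inj₁ refl = s∈S
...   | s , s∈S , inj₂ s→y with trans (sym z∈S) (subst (λ w → S w ≡ true) (only-z s→y) s∈S)
...     | ()

source∈ECDSet : ∀ {S} → IsECDSet D S → ∀ {x} → IsSource D x → S x ≡ true
source∈ECDSet {S = S} (covers , _) {x} x-source with covers x
... | s , s∈S , inj₁ x≡s = subst (λ z → S z ≡ true) (sym x≡s) s∈S
... | s , _   , inj₂ s→x = ⊥-elim (x-source s s→x)

HasArc : Digraph → Set
HasArc D = ∃[ x ] ∃[ y ] Arc D x y

record SourceArc (D : Digraph) : Set where
  constructor sourceArc
  field
    {s t}  : V D
    source : IsSource D s
    arc    : Arc D s t

record Confluence (D : Digraph) : Set where
  constructor confluence
  field
    {x₁ x₂ y} : V D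
    distinct  : x₁ ≢ x₂
    arc₁      : Arc D x₁ y
    arc₂      : Arc D x₂ y

record TwinSources (D : Digraph) : Set where
  constructor twinSources
  field
    confl   : Confluence D
  open Confluence confl
  field
    source₁ : IsSource D x₁
    source₂ : IsSource D x₂

twinSources⇒¬ECD : TwinSources D → ¬ IsECD D
twinSources⇒¬ECD (twinSources (confluence x₁≢x₂ x₁→y x₂→y) src₁ src₂) (S , ecd) =
  x₁≢x₂ (proj₂ ecd _ _ _ (source∈ECDSet ecd src₁) (inj₂ x₁→y) (source∈ECDSet ecd src₂) (inj₂ x₂→y))

⊗-sourceˡ : ∀ {G H s t} → IsSource G s → IsSource (G ⊗ H) (s , t)
⊗-sourceˡ src _ a = src _ (proj₁ a)

⊗-sourceʳ : ∀ {G H s t} → IsSource H t → IsSource (G ⊗ H) (s , t)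
⊗-sourceʳ src _ a = src _ (proj₂ a)

⊗-hasArc : HasArc G → HasArc H → HasArc (G ⊗ H)
⊗-hasArc (_ , _ , a) (_ , _ , b) = _ , _ , (a , b)

⊗-sourceArcˡ : SourceArc G → HasArc H → SourceArc (G ⊗ H)
⊗-sourceArcˡ {G} {H} (sourceArc src a) (_ , _ , b) = sourceArc (⊗-sourceˡ {G} {H} src) (a , b)

⊗-sourceArcʳ : HasArc G → SourceArc H → SourceArc (G ⊗ H)
⊗-sourceArcʳ {G} {H} (_ , _ , a) (sourceArc src b) = sourceArc (⊗-sourceʳ {G} {H} src) (a , b)

⊗-confluenceˡ : Confluence G → HasArc H → Confluence (G ⊗ H)
⊗-confluenceˡ (confluence x₁≢x₂ a₁ a₂) (_ , _ , b) =
  confluence (x₁≢x₂ ∘ cong proj₁) (a₁ , b) (a₂ , b)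

⊗-confluenceʳ : HasArc G → Confluence H → Confluence (G ⊗ H)
⊗-confluenceʳ (_ , _ , a) (confluence x₁≢x₂ b₁ b₂) =
  confluence (x₁≢x₂ ∘ cong proj₂) (a , b₁) (a , b₂)

⊗-twinSourcesˡ : SourceArc G → Confluence H → TwinSources (G ⊗ H)
⊗-twinSourcesˡ {G} {H} (sourceArc src a) (confluence x₁≢x₂ b₁ b₂) =
  twinSources (confluence (x₁≢x₂ ∘ cong proj₂) (a , b₁) (a , b₂))
              (⊗-sourceˡ {G} {H} src) (⊗-sourceˡ {G} {H} src)

⊗-twinSourcesʳ : Confluence G → SourceArc H → TwinSources (G ⊗ H)
⊗-twinSourcesʳ {G} {H} (confluence x₁≢x₂ a₁ a₂) (sourceArc src b) =
  twinSources (confluence (x₁≢x₂ ∘ cong proj₁) (a₁ , b) (a₂ , b))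
              (⊗-sourceʳ {G} {H} src) (⊗-sourceʳ {G} {H} src)

⊗-twinSources : HasArc G → TwinSources H → TwinSources (G ⊗ H)
⊗-twinSources {G} {H} arc (twinSources confl src₁ src₂) =
  twinSources (⊗-confluenceʳ arc confl) (⊗-sourceʳ {G} {H} src₁) (⊗-sourceʳ {G} {H} src₂)

-- Functional digraphs of fixed-point-free permutations

record PermutationDigraph (G : Digraph) : Set where
  field
    f f⁻¹            : V G → V G
    point            : V G
    arc⇒≡f           : ∀ {x y} → Arc G x y → y ≡ f x
    arc-f            : ∀ x → Arc G x (f x)
    f∘f⁻¹            : ∀ y → f (f⁻¹ y) ≡ y
    f-injective      : ∀ {x x′} → f x ≡ f x′ → x ≡ x′
    f-fixedPointFree : ∀ x → f x ≢ x

  arc-f⁻¹ : ∀ y → Arc G (f⁻¹ y) y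
  arc-f⁻¹ y = subst (Arc G (f⁻¹ y)) (f∘f⁻¹ y) (arc-f (f⁻¹ y))

  in-arcs-unique : ∀ {x x′ y} → Arc G x y → Arc G x′ y → x ≡ x′
  in-arcs-unique x→y x′→y = f-injective (trans (sym (arc⇒≡f x→y)) (arc⇒≡f x′→y))

  Alternating : (V G → Bool) → Set
  Alternating χ = ∀ x → χ (f x) ≡ not (χ x)

  ECDSet-alternating : ∀ {S} → IsECDSet G S → Alternating S
  ECDSet-alternating ecd x =
    ECDSet-flip ecd (arc-f x) (λ e → f-fixedPointFree x (sym e)) (λ x′→fx → f-injective (sym (arc⇒≡f x′→fx)))

  alternating-fold : ∀ {χ} → Alternating χ → ∀ x n → χ (fold x f n) ≡ fold (χ x) not n
  alternating-fold alt x zero    = refl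
  alternating-fold alt x (suc n) = trans (alt _) (cong not (alternating-fold alt x n))

  ECD⇒even-period : IsECD G → ∀ {N} → IsPeriod f N → 2 ∣ N
  ECD⇒even-period (S , ecd) {N} period = fold-not-fixed⇒2∣ N
    (trans (sym (alternating-fold (ECDSet-alternating ecd) point N)) (cong S (period point)))

  alternating⇒ECD : ∀ {χ} → Alternating χ → IsECD G
  alternating⇒ECD {χ} alt = χ , covers , unique
    where
      covers : ∀ y → ∃[ s ] (χ s ≡ true × (N⁺[ G ]∋ s) y)
      covers y with χ y in y∈χ
      ... | true  = y , y∈χ , inj₁ refl
      ... | false = f⁻¹ y , not-injective (trans (sym (alt (f⁻¹ y))) (trans (cong χ (f∘f⁻¹ y)) y∈χ)) ,
                    inj₂ (arc-f⁻¹ y)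
      arc-flips : ∀ {x y} → Arc G x y → χ y ≡ not (χ x)
      arc-flips {x} x→y = trans (cong χ (arc⇒≡f x→y)) (alt x)
      unique : ∀ y s₁ s₂ → χ s₁ ≡ true → (N⁺[ G ]∋ s₁) y → χ s₂ ≡ true → (N⁺[ G ]∋ s₂) y → s₁ ≡ s₂
      unique y s₁ s₂ _  (inj₁ refl) _  (inj₁ refl) = refl
      unique y s₁ s₂ e₁ (inj₁ refl) e₂ (inj₂ s₂→y) = ⊥-elim (not-¬ (trans e₁ (sym e₂)) (arc-flips s₂→y))
      unique y s₁ s₂ e₁ (inj₂ s₁→y) e₂ (inj₁ refl) = ⊥-elim (not-¬ (trans e₂ (sym e₁)) (arc-flips s₁→y))
      unique y s₁ s₂ _  (inj₂ s₁→y) _  (inj₂ s₂→y) = in-arcs-unique s₁→y s₂→y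

module _ (P : PermutationDigraph G) (Q : PermutationDigraph H) where
  private
    module P = PermutationDigraph P
    module Q = PermutationDigraph Q

  ⊗-permutation : PermutationDigraph (G ⊗ H)
  ⊗-permutation = record
    { f                = map P.f Q.f
    ; f⁻¹              = map P.f⁻¹ Q.f⁻¹
    ; point            = P.point , Q.point
    ; arc⇒≡f           = λ (a , b) → cong₂ _,_ (P.arc⇒≡f a) (Q.arc⇒≡f b)
    ; arc-f            = λ (x , y) → P.arc-f x , Q.arc-f y
    ; f∘f⁻¹            = λ (x , y) → cong₂ _,_ (P.f∘f⁻¹ x) (Q.f∘f⁻¹ y)
    ; f-injective      = λ e → cong₂ _,_ (P.f-injective (cong proj₁ e)) (Q.f-injective (cong proj₂ e))
    ; f-fixedPointFree = λ (x , _) e → P.f-fixedPointFree x (cong proj₁ e)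
    }

  ⊗-period : ∀ {M N} → IsPeriod P.f M → IsPeriod Q.f N → IsPeriod (map P.f Q.f) (M * N)
  ⊗-period {M} {N} perM perN (x , y) = begin
    fold (x , y) (map P.f Q.f) (M * N)      ≡⟨ fold-map P.f Q.f x y (M * N) ⟩
    fold x P.f (M * N) , fold y Q.f (M * N) ≡⟨ cong (λ k → fold x P.f k , fold y Q.f (M * N)) (*-comm M N) ⟩
    fold x P.f (N * M) , fold y Q.f (M * N) ≡⟨ cong₂ _,_ (isPeriod-* perM N x) (isPeriod-* perN M y) ⟩
    x , y                                   ∎
    where open ≡-Reasoning

  ⊗-alternatingˡ : ∀ {χ} → P.Alternating χ → PermutationDigraph.Alternating ⊗-permutation (χ ∘ proj₁)
  ⊗-alternatingˡ alt (x , _) = alt x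

  ⊗-alternatingʳ : ∀ {χ} → Q.Alternating χ → PermutationDigraph.Alternating ⊗-permutation (χ ∘ proj₂)
  ⊗-alternatingʳ alt (_ , y) = alt y

-- Discrete fibrations

record DiscreteFibration (G D : Digraph) : Set where
  field
    π           : V G → V D
    section     : V D → V G
    π∘section   : ∀ u → π (section u) ≡ u
    π-arc       : ∀ {x y} → Arc G x y → Arc D (π x) (π y)
    lift        : ∀ {u y} → Arc D u (π y) → ∃[ x ] (π x ≡ u × Arc G x y)
    lift-unique : ∀ {x x′ y} → Arc G x y → Arc G x′ y → π x ≡ π x′ → x ≡ x′

id-fibration : DiscreteFibration D D
id-fibration = record
  { π = id ; section = id ; π∘section = λ _ → refl ; π-arc = id
  ; lift = λ a → _ , refl , a ; lift-unique = λ _ _ e → e }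

fibration-⊗ʳ : DiscreteFibration G D → PermutationDigraph H → DiscreteFibration (G ⊗ H) D
fibration-⊗ʳ {G = G} {D = D} {H = H} F Q = record
  { π           = π ∘ proj₁
  ; section     = λ u → section u , Q.point
  ; π∘section   = π∘section
  ; π-arc       = π-arc ∘ proj₁
  ; lift        = lift′
  ; lift-unique = λ (a , b) (a′ , b′) e → cong₂ _,_ (lift-unique a a′ e) (Q.in-arcs-unique b b′)
  }
  where
    open DiscreteFibration F
    module Q = PermutationDigraph Q
    lift′ : ∀ {u y z} → Arc D u (π y) → ∃[ x ] (π (proj₁ x) ≡ u × Arc (G ⊗ H) x (y , z))
    lift′ {z = z} a with lift a
    ... | x , πx≡u , x→y = (x , Q.f⁻¹ z) , πx≡u , x→y , Q.arc-f⁻¹ z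

fibration-⊗ˡ : PermutationDigraph H → DiscreteFibration G D → DiscreteFibration (H ⊗ G) D
fibration-⊗ˡ {H = H} {G = G} {D = D} Q F = record
  { π           = π ∘ proj₂
  ; section     = λ u → Q.point , section u
  ; π∘section   = π∘section
  ; π-arc       = π-arc ∘ proj₂
  ; lift        = lift′
  ; lift-unique = λ (b , a) (b′ , a′) e → cong₂ _,_ (Q.in-arcs-unique b b′) (lift-unique a a′ e)
  }
  where
    open DiscreteFibration F
    module Q = PermutationDigraph Q
    lift′ : ∀ {u y z} → Arc D u (π y) → ∃[ x ] (π (proj₂ x) ≡ u × Arc (H ⊗ G) x (z , y))
    lift′ {z = z} a with lift a
    ... | x , πx≡u , x→y = (Q.f⁻¹ z , x) , πx≡u , Q.arc-f⁻¹ z , x→y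

ECD-pullback : (∀ u → ¬ Arc D u u) → DiscreteFibration G D → IsECD D → IsECD G
ECD-pullback {D = D} {G = G} loopless F (S , covers , unique) = S ∘ π , covers′ , unique′
  where
    open DiscreteFibration F

    π-N⁺ : ∀ {x y} → (N⁺[ G ]∋ x) y → (N⁺[ D ]∋ π x) (π y)
    π-N⁺ (inj₁ refl) = inj₁ refl
    π-N⁺ (inj₂ x→y)  = inj₂ (π-arc x→y)

    covers′ : ∀ y → ∃[ x ] (S (π x) ≡ true × (N⁺[ G ]∋ x) y)
    covers′ y with covers (π y)
    ... | s , s∈S , inj₁ πy≡s = y , subst (λ z → S z ≡ true) (sym πy≡s) s∈S , inj₁ refl
    ... | s , s∈S , inj₂ s→πy with lift s→πy
    ...   | x , πx≡s , x→y = x , subst (λ z → S z ≡ true) (sym πx≡s) s∈S , inj₂ x→y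

    unique′ : ∀ y x₁ x₂ → S (π x₁) ≡ true → (N⁺[ G ]∋ x₁) y →
                          S (π x₂) ≡ true → (N⁺[ G ]∋ x₂) y → x₁ ≡ x₂
    unique′ y x₁ x₂ e₁ n₁ e₂ n₂ with unique _ _ _ e₁ (π-N⁺ n₁) e₂ (π-N⁺ n₂) | n₁ | n₂
    ... | _  | inj₁ refl | inj₁ refl = refl
    ... | πe | inj₁ refl | inj₂ a₂   = ⊥-elim (loopless _ (subst (λ z → Arc D z (π y)) (sym πe) (π-arc a₂)))
    ... | πe | inj₂ a₁   | inj₁ refl = ⊥-elim (loopless _ (subst (λ z → Arc D z (π y)) πe (π-arc a₁)))
    ... | πe | inj₂ a₁   | inj₂ a₂   = lift-unique a₁ a₂ πe

-- Oriented cycles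

module OrientedCycle (c : OCycle) where

  K : ℕ
  K = len c

  C : Digraph
  C = asDigraph c

  Source Sink : Fin K → Set
  Source = IsSource C
  Sink   = IsSink C

  vertex : ℕ → Fin K
  vertex N = N mod K

  toℕ-vertex : ∀ N → toℕ (vertex N) ≡ N % K
  toℕ-vertex N = Fin.toℕ-fromℕ< _

  vertex-cong : ∀ M N → M % K ≡ N % K → vertex M ≡ vertex N
  vertex-cong M N e = Fin.toℕ-injective (trans (toℕ-vertex M) (trans e (sym (toℕ-vertex N))))

  vertex-toℕ : ∀ v → vertex (toℕ v) ≡ v
  vertex-toℕ v = Fin.toℕ-injective (trans (toℕ-vertex (toℕ v)) (m<n⇒m%n≡m (Fin.toℕ<n v)))

  vertex-+K : ∀ N → vertex (N + K) ≡ vertex N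
  vertex-+K N = vertex-cong (N + K) N ([m+n]%n≡m%n N K)

  vertex-+ : ∀ M k → vertex (toℕ (vertex M) + k) ≡ vertex (M + k)
  vertex-+ M k = vertex-cong (toℕ (vertex M) + k) (M + k)
    (trans (cong (λ z → (z + k) % K) (toℕ-vertex M)) ([m%n+k]%n≡[m+k]%n M k K))

  next-vertex : ∀ N → next c (vertex N) ≡ vertex (suc N)
  next-vertex N = begin
    vertex (suc (toℕ (vertex N))) ≡⟨ cong vertex (+-comm 1 (toℕ (vertex N))) ⟩
    vertex (toℕ (vertex N) + 1)   ≡⟨ vertex-+ N 1 ⟩
    vertex (N + 1)                ≡⟨ cong vertex (+-comm N 1) ⟩
    vertex (suc N)                ∎
    where open ≡-Reasoning

  vertex-suc-+K∸1 : ∀ v → vertex (suc (toℕ v + (K ∸ 1))) ≡ v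
  vertex-suc-+K∸1 v = begin
    vertex (suc (toℕ v + (K ∸ 1))) ≡⟨ cong vertex (+-suc (toℕ v) (K ∸ 1)) ⟨
    vertex (toℕ v + K)             ≡⟨ vertex-+K (toℕ v) ⟩
    vertex (toℕ v)                 ≡⟨ vertex-toℕ v ⟩
    v                              ∎
    where open ≡-Reasoning

  prev : Fin K → Fin K
  prev v = vertex (toℕ v + (K ∸ 1))

  next-prev : ∀ v → next c (prev v) ≡ v
  next-prev v = trans (next-vertex (toℕ v + (K ∸ 1))) (vertex-suc-+K∸1 v)

  prev-next : ∀ v → prev (next c v) ≡ v
  prev-next v = trans (vertex-+ (suc (toℕ v)) (K ∸ 1)) (vertex-suc-+K∸1 v)

  next-injective : ∀ {u v} → next c u ≡ next c v → u ≡ v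
  next-injective {u} {v} e = trans (sym (prev-next u)) (trans (cong prev e) (prev-next v))

  prev-injective : ∀ {u v} → prev u ≡ prev v → u ≡ v
  prev-injective {u} {v} e = trans (sym (next-prev u)) (trans (cong (next c) e) (next-prev v))

  prev-vertex : ∀ N → prev (vertex (suc N)) ≡ vertex N
  prev-vertex N = trans (cong prev (sym (next-vertex N))) (prev-next (vertex N))

  -- The cycle has at least three vertices, so one or two steps never return.
  vertex-+j≢ : ∀ v j → 0 < j → j < 3 → vertex (toℕ v + j) ≢ v
  vertex-+j≢ v j 0<j j<3 e = [m+j]%n≢m (toℕ v) j K (Fin.toℕ<n v) 0<j (≤-trans j<3 (m≤m+n 3 (n c)))
    (trans (sym (toℕ-vertex (toℕ v + j))) (cong toℕ e))

  next≢id : ∀ v → next c v ≢ v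
  next≢id v e = vertex-+j≢ v 1 z<s (s≤s (s≤s z≤n))
    (trans (cong vertex (+-comm (toℕ v) 1)) e)

  next²≢id : ∀ v → next c (next c v) ≢ v
  next²≢id v e = vertex-+j≢ v 2 z<s ≤-refl (begin
    vertex (toℕ v + 2)                  ≡⟨ cong vertex (+-comm (toℕ v) 2) ⟩
    vertex (suc (suc (toℕ v)))          ≡⟨ next-vertex (suc (toℕ v)) ⟨
    next c (vertex (suc (toℕ v)))       ≡⟨⟩
    next c (next c v)                   ≡⟨ e ⟩
    v                                   ∎)
    where open ≡-Reasoning

  prev≢next : ∀ v → prev v ≢ next c v
  prev≢next v e = next²≢id v (trans (cong (next c) (sym e)) (next-prev v))

  fold-next : ∀ x j → fold x (next c) j ≡ vertex (toℕ x + j)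
  fold-next x zero    = sym (trans (cong vertex (+-identityʳ (toℕ x))) (vertex-toℕ x))
  fold-next x (suc j) = begin
    next c (fold x (next c) j)   ≡⟨ cong (next c) (fold-next x j) ⟩
    next c (vertex (toℕ x + j))  ≡⟨ next-vertex (toℕ x + j) ⟩
    vertex (suc (toℕ x + j))     ≡⟨ cong vertex (+-suc (toℕ x) j) ⟨
    vertex (toℕ x + suc j)       ∎
    where open ≡-Reasoning

  next-period : IsPeriod (next c) K
  next-period x = trans (fold-next x K) (trans (vertex-+K (toℕ x)) (vertex-toℕ x))

  prev-period : IsPeriod prev K
  prev-period = isPeriod-inverse {g = next c} {h = prev} {N = K} next-prev next-period

  loopless : ∀ v → ¬ CArc c v v
  loopless v (inj₁ (e , _)) = next≢id v (sym e)
  loopless v (inj₂ (e , _)) = next≢id v (sym e)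

  orientAt : ℕ → Bool
  orientAt N = orient c (vertex N)

  orientAt-toℕ : ∀ v → orientAt (toℕ v) ≡ orient c v
  orientAt-toℕ v = cong (orient c) (vertex-toℕ v)

  forward-arc : ∀ N → orientAt N ≡ true → CArc c (vertex N) (vertex (suc N))
  forward-arc N e = inj₁ (sym (next-vertex N) , e)

  backward-arc : ∀ N → orientAt N ≡ false → CArc c (vertex (suc N)) (vertex N)
  backward-arc N e = inj₂ (sym (next-vertex N) , e)

  arc-from-prev : ∀ {v} → orient c (prev v) ≡ true → CArc c (prev v) v
  arc-from-prev {v} e = inj₁ (sym (next-prev v) , e)

  arc-from-next : ∀ {v} → orient c v ≡ false → CArc c (next c v) v
  arc-from-next e = inj₂ (refl , e)

  in-neighbour : ∀ {u v} → CArc c u v →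
    (u ≡ prev v × orient c (prev v) ≡ true) ⊎ (u ≡ next c v × orient c v ≡ false)
  in-neighbour {u} (inj₁ (refl , e)) =
    inj₁ (sym (prev-next u) , subst (λ w → orient c w ≡ true) (sym (prev-next u)) e)
  in-neighbour (inj₂ e) = inj₂ e

  source⇒orient : ∀ {v} → Source v → orient c v ≡ true
  source⇒orient {v} src = ¬-not λ e → src (next c v) (arc-from-next e)

  source⇒orient-prev : ∀ {v} → Source v → orient c (prev v) ≡ false
  source⇒orient-prev {v} src = ¬-not λ e → src (prev v) (arc-from-prev e)

  sink⇒orient : ∀ {v} → Sink v → orient c v ≡ false
  sink⇒orient {v} snk = ¬-not λ e → snk (next c v) (inj₁ (refl , e))

  sink⇒orient-prev : ∀ {v} → Sink v → orient c (prev v) ≡ true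
  sink⇒orient-prev {v} snk = ¬-not λ e → snk (prev v) (inj₂ (sym (next-prev v) , e))

  orient⇒sink : ∀ {v} → orient c v ≡ false → orient c (prev v) ≡ true → Sink v
  orient⇒sink e _  _ (inj₁ (_ , e′))    = not-¬ e e′
  orient⇒sink _ e′ w (inj₂ (refl , e)) = not-¬ e′ (trans (cong (orient c) (prev-next w)) e)

  orient⇒source : ∀ {v} → orient c v ≡ true → orient c (prev v) ≡ false → Source v
  orient⇒source _ e′ u (inj₁ (refl , e)) = not-¬ e′ (trans (cong (orient c) (prev-next u)) e)
  orient⇒source e _  _ (inj₂ (_ , e′))    = not-¬ e e′

  sink? : ∀ v → Dec (Sink v)
  sink? v with orient c v ≟ᵇ false | orient c (prev v) ≟ᵇ true
  ... | yes e | yes e′ = yes (orient⇒sink e e′)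
  ... | no ¬e | _      = no (¬e ∘ sink⇒orient)
  ... | _     | no ¬e′ = no (¬e′ ∘ sink⇒orient-prev)

  in-neighbour-unique : ∀ {u u′ v} → ¬ Sink v → CArc c u v → CArc c u′ v → u ≡ u′
  in-neighbour-unique ¬snk a a′ with in-neighbour a | in-neighbour a′
  ... | inj₁ (refl , _) | inj₁ (refl , _) = refl
  ... | inj₂ (refl , _) | inj₂ (refl , _) = refl
  ... | inj₁ (_ , e)    | inj₂ (_ , e′)   = ⊥-elim (¬snk (orient⇒sink e′ e))
  ... | inj₂ (_ , e′)   | inj₁ (_ , e)    = ⊥-elim (¬snk (orient⇒sink e′ e))

  orientation-switch : ∀ {b} fuel a → orientAt a ≡ b → orientAt (a + fuel) ≡ not b →
    ∃[ j ] (orientAt j ≡ b × orientAt (suc j) ≡ not b)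
  orientation-switch zero a e e′ = ⊥-elim (not-¬ e (trans (cong orientAt (sym (+-identityʳ a))) e′))
  orientation-switch {b} (suc fuel) a e e′ with orientAt (suc a) ≟ᵇ b
  ... | yes e₁ = orientation-switch fuel (suc a) e₁ (trans (cong orientAt (sym (+-suc a fuel))) e′)
  ... | no ¬e₁ = a , e , ¬-not ¬e₁

  switch⇒source : ∀ j → orientAt j ≡ false → orientAt (suc j) ≡ true → Source (vertex (suc j))
  switch⇒source j e e′ = orient⇒source e′ (trans (cong (orient c) (prev-vertex j)) e)

  source⇒sourceArc : ∀ {s} → Source s → SourceArc C
  source⇒sourceArc src = sourceArc src (inj₁ (refl , source⇒orient src))

  source⇒confluence : ∀ {s} → Source s → Confluence C
  source⇒confluence {s} src
    with orientation-switch (K ∸ 1) (toℕ s) (trans (orientAt-toℕ s) (source⇒orient src))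
                            (source⇒orient-prev src)
  ... | j , e , e′ = confluence distinct (forward-arc j e) (arc-from-next e′)
    where
      distinct : vertex j ≢ next c (vertex (suc j))
      distinct eq = next²≢id (vertex j) (trans (cong (next c) (next-vertex j)) (sym eq))

  hasArc : HasArc C
  hasArc with orient c fzero in e
  ... | true  = fzero , next c fzero , inj₁ (refl , e)
  ... | false = next c fzero , fzero , inj₂ (refl , e)

  orientAt-+K : ∀ v → orientAt (toℕ v + K) ≡ orient c v
  orientAt-+K v = cong (orient c) (trans (vertex-+K (toℕ v)) (vertex-toℕ v))

  orientAt-ahead : ∀ u v → orientAt (toℕ u + (toℕ v + K ∸ toℕ u)) ≡ orient c v
  orientAt-ahead u v =
    trans (cong orientAt (m+[n∸m]≡n (≤-trans (<⇒≤ (Fin.toℕ<n u)) (m≤n+m K (toℕ v))))) (orientAt-+K v)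

  orientation-change⇒source : ∀ {u v} → orient c u ≡ false → orient c v ≡ true → ∃ Source
  orientation-change⇒source {u} {v} eu ev
    with orientation-switch (toℕ v + K ∸ toℕ u) (toℕ u) (trans (orientAt-toℕ u) eu)
                            (trans (orientAt-ahead u v) ev)
  ... | j , e , e′ = vertex (suc j) , switch⇒source j e e′

  sourceless⇒orient-constant : (∀ v → ¬ Source v) → ∀ u v → orient c u ≡ orient c v
  sourceless⇒orient-constant none u v with orient c u in eu | orient c v in ev
  ... | true  | true  = refl
  ... | false | false = refl
  ... | false | true  = ⊥-elim (uncurry none (orientation-change⇒source eu ev))
  ... | true  | false = ⊥-elim (uncurry none (orientation-change⇒source ev eu))

  Reachable : Fin K → Set
  Reachable v = ∃[ w ] ∃[ d ] (Source w × SinkFreePath C w v d)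

  source-reachable : ∀ {w} → Source w → Reachable w
  source-reachable src = _ , 0 , src , stop

  reachable-snoc : ∀ {u v} → Reachable u → CArc c u v → Reachable v
  reachable-snoc (w , d , src , p) u→v = w , suc d , src , snoc p (arc⇒¬sink {D = C} u→v) u→v

  reachable-via-successors : ∀ fuel N → orientAt N ≡ false → orientAt (N + fuel) ≡ true →
    Reachable (vertex N)
  reachable-via-successors zero N e e′ =
    ⊥-elim (not-¬ e (trans (cong orientAt (sym (+-identityʳ N))) e′))
  reachable-via-successors (suc fuel) N e e′ =
    reachable-snoc (from-successor (orientAt (suc N)) refl) (backward-arc N e)
    where
      from-successor : ∀ b → orientAt (suc N) ≡ b → Reachable (vertex (suc N))
      from-successor true  e₁ = source-reachable (switch⇒source N e e₁)
      from-successor false e₁ =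
        reachable-via-successors fuel (suc N) e₁ (trans (cong orientAt (sym (+-suc N fuel))) e′)

  reachable-via-predecessors : ∀ fuel m → orientAt m ≡ false → orientAt (fuel + m) ≡ true →
    Reachable (vertex (suc (fuel + m)))
  reachable-via-predecessors zero       m e e′ = ⊥-elim (not-¬ e e′)
  reachable-via-predecessors (suc fuel) m e e′ =
    reachable-snoc (from-predecessor (orientAt (fuel + m)) refl) (forward-arc (suc (fuel + m)) e′)
    where
      from-predecessor : ∀ b → orientAt (fuel + m) ≡ b → Reachable (vertex (suc (fuel + m)))
      from-predecessor false e₁ = source-reachable (switch⇒source (fuel + m) e₁ e′)
      from-predecessor true  e₁ = reachable-via-predecessors fuel m e e₁

  -- Every vertex is reached by walking backwards along arcs until a source is met.
  all-reachable : ∀ {s} → Source s → ∀ v → Reachable v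
  all-reachable {s} src v with orient c (prev v) in ep
  ... | true = subst Reachable reached
                 (reachable-via-predecessors (N ∸ m) m (trans (orientAt-toℕ (prev s)) (source⇒orient-prev src))
                   (trans (cong orientAt (m∸n+n≡m m≤N)) (trans (orientAt-+K (prev v)) ep)))
    where
      m = toℕ (prev s)
      N = toℕ (prev v) + K
      m≤N : m ≤ N
      m≤N = ≤-trans (<⇒≤ (Fin.toℕ<n (prev s))) (m≤n+m K (toℕ (prev v)))
      reached : vertex (suc (N ∸ m + m)) ≡ v
      reached = begin
        vertex (suc (N ∸ m + m))  ≡⟨ cong (vertex ∘ suc) (m∸n+n≡m m≤N) ⟩
        vertex (suc N)            ≡⟨ next-vertex N ⟨
        next c (vertex N)         ≡⟨ cong (next c) (trans (vertex-+K (toℕ (prev v))) (vertex-toℕ (prev v))) ⟩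
        next c (prev v)           ≡⟨ next-prev v ⟩
        v                         ∎
        where open ≡-Reasoning
  ... | false with orient c v in ev
  ...   | true  = source-reachable (orient⇒source ev ep)
  ...   | false = subst Reachable (vertex-toℕ v)
                    (reachable-via-successors (toℕ s + K ∸ toℕ v) (toℕ v) (trans (orientAt-toℕ v) ev)
                      (trans (orientAt-ahead v s) (source⇒orient src)))

  path-length-unique : ∀ {w w′ v d d′} → Source w → Source w′ → ¬ Sink v →
    SinkFreePath C w v d → SinkFreePath C w′ v d′ → d ≡ d′
  path-length-unique {d = zero}  {zero}   _   _    _ _ _ = refl
  path-length-unique {d = zero}  {suc _}  src _    _ stop p′ with unsnoc p′
  ... | u , _ , _ , u→w = ⊥-elim (src u u→w)
  path-length-unique {d = suc _} {zero}   _   src′ _ p stop with unsnoc p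
  ... | u , _ , _ , u→w′ = ⊥-elim (src′ u u→w′)
  path-length-unique {d = suc _} {suc _}  src src′ v-live p p′ with unsnoc p | unsnoc p′
  ... | u , q , u-live , u→v | u′ , q′ , _ , u′→v with in-neighbour-unique v-live u→v u′→v
  ...   | refl = cong suc (path-length-unique src src′ u-live q q′)

  module Distance {s} (s-source : Source s) where

    distance : Fin K → ℕ
    distance v = proj₁ (proj₂ (all-reachable s-source v))

    distance-unique : ∀ {w x d} → Source w → ¬ Sink x → SinkFreePath C w x d → distance x ≡ d
    distance-unique {x = x} src live p =
      let _ , _ , src₀ , p₀ = all-reachable s-source x in path-length-unique src₀ src live p₀ p

    distance-arc : ∀ {u x} → CArc c u x → ¬ Sink x → distance x ≡ suc (distance u)
    distance-arc {u} u→x live =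
      let _ , _ , src , p = all-reachable s-source u
      in distance-unique src live (snoc p (arc⇒¬sink {D = C} u→x) u→x)

    inS : Fin K → Bool
    inS v = if does (sink? v)
              then not (isEven (distance (prev v)) ∨ isEven (distance (next c v)))
              else isEven (distance v)

    inS-live : ∀ {v} → ¬ Sink v → inS v ≡ isEven (distance v)
    inS-live {v} live with sink? v
    ... | yes snk = ⊥-elim (live snk)
    ... | no  _   = refl

    inS-sink : ∀ {v} → Sink v → inS v ≡ not (isEven (distance (prev v)) ∨ isEven (distance (next c v)))
    inS-sink {v} snk with sink? v
    ... | yes _    = refl
    ... | no  live = ⊥-elim (live snk)

    inS⇒even : ∀ {u x} → CArc c u x → inS u ≡ true → isEven (distance u) ≡ true
    inS⇒even u→x e = trans (sym (inS-live (arc⇒¬sink {D = C} u→x))) e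

    Covered : Fin K → Set
    Covered x = ∃[ s′ ] (inS s′ ≡ true × (N⁺[ C ]∋ s′) x)

    covered-live : ∀ {w x d} → Source w → ¬ Sink x → SinkFreePath C w x d → Covered x
    covered-live {x = x} {d = zero} src live p =
      x , trans (inS-live live) (cong isEven (distance-unique src live p)) , inj₁ refl
    covered-live {x = x} {d = suc d} src live p with unsnoc p | isEven d in e
    ... | u , q , u-live , u→x | true  =
      u , trans (inS-live u-live) (trans (cong isEven (distance-unique src u-live q)) e) , inj₂ u→x
    ... | _                    | false =
      x , trans (inS-live live) (trans (cong isEven (distance-unique src live p)) (cong not e)) , inj₁ refl

    covered-sink : ∀ {x} → Sink x → Covered x
    covered-sink {x} snk with isEven (distance (prev x)) in e₁ | isEven (distance (next c x)) in e₂
    ... | true  | _     = prev x , trans (inS-live (arc⇒¬sink {D = C} a₁)) e₁ , inj₂ a₁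
      where a₁ = arc-from-prev (sink⇒orient-prev snk)
    ... | false | true  = next c x , trans (inS-live (arc⇒¬sink {D = C} a₂)) e₂ , inj₂ a₂
      where a₂ = arc-from-next (sink⇒orient snk)
    ... | false | false = x , trans (inS-sink snk) (cong₂ (λ a b → not (a ∨ b)) e₁ e₂) , inj₁ refl

    covered-by : ∀ {x} → Dec (Sink x) → Covered x
    covered-by (yes snk)          = covered-sink snk
    covered-by {x} (no live) = let _ , _ , src , p = all-reachable s-source x in covered-live src live p

    inS-sink-in-neighbour-odd : ∀ {u x} → Sink x → inS x ≡ true → CArc c u x → isEven (distance u) ≢ true
    inS-sink-in-neighbour-odd snk x∈S u→x with in-neighbour u→x
    ... | inj₁ (refl , _) = λ e → ≡true⇒not-∨≢trueˡ e (trans (sym (inS-sink snk)) x∈S)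
    ... | inj₂ (refl , _) = λ e → ≡true⇒not-∨≢trueʳ e (trans (sym (inS-sink snk)) x∈S)

    inS-independent : ∀ {u x} → Dec (Sink x) → inS x ≡ true → CArc c u x → inS u ≢ true
    inS-independent (yes snk) x∈S u→x u∈S = inS-sink-in-neighbour-odd snk x∈S u→x (inS⇒even u→x u∈S)
    inS-independent (no live) x∈S u→x u∈S = ≡true⇒not≢true (inS⇒even u→x u∈S)
      (trans (cong isEven (sym (distance-arc u→x live))) (trans (sym (inS-live live)) x∈S))

    module _ (sinks-even : SinksEvenToSource c) where

      in-neighbours-of-sink-not-both-even : ∀ {x} → Sink x →
        isEven (distance (prev x)) ≡ true → isEven (distance (next c x)) ≡ true → ⊥
      in-neighbours-of-sink-not-both-even {x} snk e₁ e₂ with sinks-even x snk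
      ... | _ , zero  , (src , stop) , _   = src (prev x) (arc-from-prev (sink⇒orient-prev snk))
      ... | _ , suc d , (src , p)    , 2∣d with unsnoc p
      ...   | u , q , u-live , u→x = ≡true⇒not≢true u-even (2∣⇒isEven 2∣d)
        where
          u-even : isEven d ≡ true
          u-even with in-neighbour u→x
          ... | inj₁ (refl , _) = trans (cong isEven (sym (distance-unique src u-live q))) e₁
          ... | inj₂ (refl , _) = trans (cong isEven (sym (distance-unique src u-live q))) e₂

      in-neighbours-in-S-unique : ∀ {x s₁ s₂} → Dec (Sink x) →
        inS s₁ ≡ true → CArc c s₁ x → inS s₂ ≡ true → CArc c s₂ x → s₁ ≡ s₂
      in-neighbours-in-S-unique (no live) _ a₁ _ a₂ = in-neighbour-unique live a₁ a₂
      in-neighbours-in-S-unique (yes snk) e₁ a₁ e₂ a₂ with in-neighbour a₁ | in-neighbour a₂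
      ... | inj₁ (refl , _) | inj₁ (refl , _) = refl
      ... | inj₂ (refl , _) | inj₂ (refl , _) = refl
      ... | inj₁ (refl , _) | inj₂ (refl , _) =
        ⊥-elim (in-neighbours-of-sink-not-both-even snk (inS⇒even a₁ e₁) (inS⇒even a₂ e₂))
      ... | inj₂ (refl , _) | inj₁ (refl , _) =
        ⊥-elim (in-neighbours-of-sink-not-both-even snk (inS⇒even a₂ e₂) (inS⇒even a₁ e₁))

      unique : ∀ x s₁ s₂ → inS s₁ ≡ true → (N⁺[ C ]∋ s₁) x → inS s₂ ≡ true → (N⁺[ C ]∋ s₂) x → s₁ ≡ s₂
      unique x _ _ _  (inj₁ refl) _  (inj₁ refl) = refl
      unique x _ _ e₁ (inj₁ refl) e₂ (inj₂ a₂)   = ⊥-elim (inS-independent (sink? x) e₁ a₂ e₂)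
      unique x _ _ e₁ (inj₂ a₁)   e₂ (inj₁ refl) = ⊥-elim (inS-independent (sink? x) e₂ a₁ e₁)
      unique x _ _ e₁ (inj₂ a₁)   e₂ (inj₂ a₂)   = in-neighbours-in-S-unique (sink? x) e₁ a₁ e₂ a₂

      sinksEven⇒ECD : IsECD C
      sinksEven⇒ECD = inS , (λ x → covered-by (sink? x)) , unique

  module _ {G} (F : DiscreteFibration G C) {S} (ecd : IsECDSet G S) where
    open DiscreteFibration F

    fibre-parity : ∀ {w x d} → Source w → ¬ Sink x → SinkFreePath C w x d → ∀ y → π y ≡ x → S y ≡ isEven d
    fibre-parity {d = zero} src _ stop y refl = source∈ECDSet ecd (λ z z→y → src (π z) (π-arc z→y))
    fibre-parity {d = suc d} src live p y refl with unsnoc p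
    ... | u , q , u-live , u→πy with lift u→πy
    ...   | z , refl , z→y =
      trans (ECDSet-flip ecd z→y z≢y only-z) (cong not (fibre-parity src u-live q z refl))
      where
        z≢y : z ≢ y
        z≢y refl = loopless _ (π-arc z→y)
        only-z : ∀ {z′} → Arc G z′ y → z′ ≡ z
        only-z z′→y = lift-unique z′→y z→y (in-neighbour-unique live (π-arc z′→y) (π-arc z→y))

    even-in-neighbours-coincide : ∀ {x u₁ u₂ w₁ w₂ d₁ d₂} → CArc c u₁ x → CArc c u₂ x →
      Source w₁ → SinkFreePath C w₁ u₁ d₁ → isEven d₁ ≡ true →
      Source w₂ → SinkFreePath C w₂ u₂ d₂ → isEven d₂ ≡ true → u₁ ≡ u₂
    even-in-neighbours-coincide {x} a₁ a₂ src₁ p₁ e₁ src₂ p₂ e₂ =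
      let z₁ , πz₁ , z₁→y = lift-to-section a₁
          z₂ , πz₂ , z₂→y = lift-to-section a₂
          z₁∈S = trans (fibre-parity src₁ (arc⇒¬sink {D = C} a₁) p₁ z₁ πz₁) e₁
          z₂∈S = trans (fibre-parity src₂ (arc⇒¬sink {D = C} a₂) p₂ z₂ πz₂) e₂
      in trans (sym πz₁) (trans (cong π (proj₂ ecd _ z₁ z₂ z₁∈S (inj₂ z₁→y) z₂∈S (inj₂ z₂→y))) πz₂)
      where
        lift-to-section : ∀ {u} → CArc c u x → ∃[ z ] (π z ≡ u × Arc G z (section x))
        lift-to-section {u} a = lift (subst (CArc c u) (sym (π∘section x)) a)

    ECD⇒sinksEven : ∀ {s} → Source s → SinksEvenToSource c
    ECD⇒sinksEven s-source x snk
      with all-reachable s-source (prev x) | all-reachable s-source (next c x)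
    ... | w₁ , d₁ , src₁ , p₁ | w₂ , d₂ , src₂ , p₂ with isEven d₁ in e₁ | isEven d₂ in e₂
    ... | false | _     =
      w₁ , suc d₁ , (src₁ , snoc p₁ (arc⇒¬sink {D = C} a₁) a₁) , isEven⇒2∣ (suc d₁) (cong not e₁)
      where a₁ = arc-from-prev (sink⇒orient-prev snk)
    ... | true  | false =
      w₂ , suc d₂ , (src₂ , snoc p₂ (arc⇒¬sink {D = C} a₂) a₂) , isEven⇒2∣ (suc d₂) (cong not e₂)
      where a₂ = arc-from-next (sink⇒orient snk)
    ... | true  | true  = ⊥-elim (prev≢next x
      (even-in-neighbours-coincide (arc-from-prev (sink⇒orient-prev snk)) (arc-from-next (sink⇒orient snk))
                                   src₁ p₁ e₁ src₂ p₂ e₂))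

  Uniform : Set
  Uniform = (∀ v → orient c v ≡ true) ⊎ (∀ v → orient c v ≡ false)

  sourceless⇒Uniform : (∀ v → ¬ Source v) → Uniform
  sourceless⇒Uniform none with orient c fzero in e
  ... | true  = inj₁ λ v → trans (sourceless⇒orient-constant none v fzero) e
  ... | false = inj₂ λ v → trans (sourceless⇒orient-constant none v fzero) e

  uniform-permutation : Uniform → PermutationDigraph C
  uniform-permutation (inj₁ forward) = record
    { f = next c ; f⁻¹ = prev ; point = fzero
    ; arc⇒≡f = λ { (inj₁ (e , _)) → e ; (inj₂ (_ , e)) → ⊥-elim (not-¬ e (forward _)) }
    ; arc-f = λ x → inj₁ (refl , forward x)
    ; f∘f⁻¹ = next-prev ; f-injective = next-injective ; f-fixedPointFree = next≢id }
  uniform-permutation (inj₂ backward) = record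
    { f = prev ; f⁻¹ = next c ; point = fzero
    ; arc⇒≡f = λ { (inj₁ (_ , e)) → ⊥-elim (not-¬ (backward _) e)
                 ; {y = y} (inj₂ (refl , _)) → sym (prev-next y) }
    ; arc-f = λ x → inj₂ (sym (next-prev x) , backward (prev x))
    ; f∘f⁻¹ = prev-next ; f-injective = prev-injective
    ; f-fixedPointFree = λ x e → next≢id x (trans (cong (next c) (sym e)) (next-prev x)) }

  uniform-period : ∀ u → IsPeriod (PermutationDigraph.f (uniform-permutation u)) K
  uniform-period (inj₁ _) = next-period
  uniform-period (inj₂ _) = prev-period

  isEven-toℕ-next : 2 ∣ K → ∀ x → isEven (toℕ (next c x)) ≡ not (isEven (toℕ x))
  isEven-toℕ-next 2∣K x with suc (toℕ x) <? K
  ... | yes 1+x<K = cong isEven (trans (toℕ-vertex (suc (toℕ x))) (m<n⇒m%n≡m 1+x<K))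
  ... | no  1+x≮K = begin
    isEven (toℕ (next c x))   ≡⟨ cong isEven (toℕ-vertex (suc (toℕ x))) ⟩
    isEven (suc (toℕ x) % K)  ≡⟨ cong (λ k → isEven (k % K)) 1+x≡K ⟩
    isEven (K % K)            ≡⟨ cong isEven (n%n≡0 K) ⟩
    true                      ≡⟨ 2∣⇒isEven 2∣K ⟨
    isEven K                  ≡⟨ cong isEven 1+x≡K ⟨
    not (isEven (toℕ x))      ∎
    where
      open ≡-Reasoning
      1+x≡K : suc (toℕ x) ≡ K
      1+x≡K = ≤-antisym (Fin.toℕ<n x) (≮⇒≥ 1+x≮K)

  uniform-alternating : ∀ u → 2 ∣ K → PermutationDigraph.Alternating (uniform-permutation u) (isEven ∘ toℕ)
  uniform-alternating (inj₁ _) 2∣K = isEven-toℕ-next 2∣K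
  uniform-alternating (inj₂ _) 2∣K x = begin
    isEven (toℕ (prev x))                     ≡⟨ not-involutive _ ⟨
    not (not (isEven (toℕ (prev x))))         ≡⟨ cong not (isEven-toℕ-next 2∣K (prev x)) ⟨
    not (isEven (toℕ (next c (prev x))))      ≡⟨ cong (not ∘ isEven ∘ toℕ) (next-prev x) ⟩
    not (isEven (toℕ x))                      ∎
    where open ≡-Reasoning

  p≡0⇒sourceless : p c ≡ 0 → ∀ v → ¬ Source v
  p≡0⇒sourceless p≡0 v src =
    <⇒≢ (filter-some (IsSource? c) (lose (∈-tabulate⁺ {f = id} v) src)) (sym p≡0)

  p≢0⇒source : p c ≢ 0 → ∃ Source
  p≢0⇒source p≢0 with Fin.any? (IsSource? c)
  ... | yes src = src
  ... | no  none = ⊥-elim (p≢0 (cong length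
          (filter-none (IsSource? c) (All.tabulate⁺ {f = id} (λ v src → none (v , src))))))

  p≡0⇒uniform : p c ≡ 0 → Uniform
  p≡0⇒uniform = sourceless⇒Uniform ∘ p≡0⇒sourceless

  p≡0⇒permutation : p c ≡ 0 → PermutationDigraph C
  p≡0⇒permutation = uniform-permutation ∘ p≡0⇒uniform

  p≡0⇒period : ∀ p≡0 → IsPeriod (PermutationDigraph.f (p≡0⇒permutation p≡0)) K
  p≡0⇒period = uniform-period ∘ p≡0⇒uniform

  p≡0⇒alternating : ∀ p≡0 → 2 ∣ K → PermutationDigraph.Alternating (p≡0⇒permutation p≡0) (isEven ∘ toℕ)
  p≡0⇒alternating = uniform-alternating ∘ p≡0⇒uniform

-- Products of oriented cycles

module OC = OrientedCycle

Sourced : OCycle → Set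
Sourced c = p c ≢ 0

family-hasArc : ∀ {m} (cs : Vec OCycle (suc m)) → HasArc (prodCycles cs)
family-hasArc (c ∷ [])      = OC.hasArc c
family-hasArc (c ∷ c′ ∷ cs) = ⊗-hasArc (OC.hasArc c) (family-hasArc (c′ ∷ cs))

factor-sourceArc : ∀ {m} (cs : Vec OCycle (suc m)) i → Sourced (lookup cs i) → SourceArc (prodCycles cs)
factor-sourceArc (c ∷ [])      fzero    sc = OC.source⇒sourceArc c (proj₂ (OC.p≢0⇒source c sc))
factor-sourceArc (c ∷ c′ ∷ cs) fzero    sc =
  ⊗-sourceArcˡ (OC.source⇒sourceArc c (proj₂ (OC.p≢0⇒source c sc))) (family-hasArc (c′ ∷ cs))
factor-sourceArc (c ∷ c′ ∷ cs) (fsuc i) sc = ⊗-sourceArcʳ (OC.hasArc c) (factor-sourceArc (c′ ∷ cs) i sc)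

factor-confluence : ∀ {m} (cs : Vec OCycle (suc m)) i → Sourced (lookup cs i) → Confluence (prodCycles cs)
factor-confluence (c ∷ [])      fzero    sc = OC.source⇒confluence c (proj₂ (OC.p≢0⇒source c sc))
factor-confluence (c ∷ c′ ∷ cs) fzero    sc =
  ⊗-confluenceˡ (OC.source⇒confluence c (proj₂ (OC.p≢0⇒source c sc))) (family-hasArc (c′ ∷ cs))
factor-confluence (c ∷ c′ ∷ cs) (fsuc i) sc = ⊗-confluenceʳ (OC.hasArc c) (factor-confluence (c′ ∷ cs) i sc)

two-sourced-factors⇒twinSources : ∀ {m} (cs : Vec OCycle (suc m)) i j → i ≢ j →
  Sourced (lookup cs i) → Sourced (lookup cs j) → TwinSources (prodCycles cs)
two-sourced-factors⇒twinSources (c ∷ [])      fzero    fzero    i≢j _ _ = ⊥-elim (i≢j refl)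
two-sourced-factors⇒twinSources (c ∷ c′ ∷ cs) fzero    fzero    i≢j _ _ = ⊥-elim (i≢j refl)
two-sourced-factors⇒twinSources (c ∷ c′ ∷ cs) fzero    (fsuc j) _ sc sj =
  ⊗-twinSourcesˡ (OC.source⇒sourceArc c (proj₂ (OC.p≢0⇒source c sc))) (factor-confluence (c′ ∷ cs) j sj)
two-sourced-factors⇒twinSources (c ∷ c′ ∷ cs) (fsuc i) fzero    _ si sc =
  ⊗-twinSourcesʳ (OC.source⇒confluence c (proj₂ (OC.p≢0⇒source c sc))) (factor-sourceArc (c′ ∷ cs) i si)
two-sourced-factors⇒twinSources (c ∷ c′ ∷ cs) (fsuc i) (fsuc j) i≢j si sj =
  ⊗-twinSources (OC.hasArc c) (two-sourced-factors⇒twinSources (c′ ∷ cs) i j (i≢j ∘ cong fsuc) si sj)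

Sourceless : ∀ {m} → Vec OCycle (suc m) → Set
Sourceless cs = ∀ i → p (lookup cs i) ≡ 0

sourceless-permutation : ∀ {m} (cs : Vec OCycle (suc m)) → Sourceless cs → PermutationDigraph (prodCycles cs)
sourceless-permutation (c ∷ [])      none = OC.p≡0⇒permutation c (none fzero)
sourceless-permutation (c ∷ c′ ∷ cs) none =
  ⊗-permutation (OC.p≡0⇒permutation c (none fzero))
                (sourceless-permutation (c′ ∷ cs) (none ∘ fsuc))

sourceless-odd-period : ∀ {m} (cs : Vec OCycle (suc m)) (none : Sourceless cs) →
  (∀ i → ¬ 2 ∣ len (lookup cs i)) →
  ∃[ N ] (¬ 2 ∣ N × IsPeriod (PermutationDigraph.f (sourceless-permutation cs none)) N)
sourceless-odd-period (c ∷ [])      none odd = len c , odd fzero , OC.p≡0⇒period c (none fzero)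
sourceless-odd-period (c ∷ c′ ∷ cs) none odd with sourceless-odd-period (c′ ∷ cs) (none ∘ fsuc) (odd ∘ fsuc)
... | N , N-odd , period =
  len c * N , odd-* (odd fzero) N-odd ,
  ⊗-period (OC.p≡0⇒permutation c (none fzero)) (sourceless-permutation (c′ ∷ cs) (none ∘ fsuc))
           {len c} {N} (OC.p≡0⇒period c (none fzero)) period

sourceless-even-factor⇒alternating : ∀ {m} (cs : Vec OCycle (suc m)) (none : Sourceless cs) i →
  2 ∣ len (lookup cs i) → ∃[ χ ] PermutationDigraph.Alternating (sourceless-permutation cs none) χ
sourceless-even-factor⇒alternating (c ∷ [])      none fzero    even = _ , OC.p≡0⇒alternating c (none fzero) even
sourceless-even-factor⇒alternating (c ∷ c′ ∷ cs) none fzero    even =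
  _ , ⊗-alternatingˡ (OC.p≡0⇒permutation c (none fzero)) (sourceless-permutation (c′ ∷ cs) (none ∘ fsuc))
                     (OC.p≡0⇒alternating c (none fzero) even)
sourceless-even-factor⇒alternating (c ∷ c′ ∷ cs) none (fsuc i) even =
  _ , ⊗-alternatingʳ (OC.p≡0⇒permutation c (none fzero)) (sourceless-permutation (c′ ∷ cs) (none ∘ fsuc))
                     (proj₂ (sourceless-even-factor⇒alternating (c′ ∷ cs) (none ∘ fsuc) i even))

fibration-onto-factor : ∀ {m} (cs : Vec OCycle (suc m)) j → (∀ i → i ≢ j → p (lookup cs i) ≡ 0) →
  DiscreteFibration (prodCycles cs) (asDigraph (lookup cs j))
fibration-onto-factor (c ∷ [])      fzero    _      = id-fibration
fibration-onto-factor (c ∷ c′ ∷ cs) fzero    others =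
  fibration-⊗ʳ id-fibration (sourceless-permutation (c′ ∷ cs) (λ i → others (fsuc i) λ ()))
fibration-onto-factor (c ∷ c′ ∷ cs) (fsuc j) others =
  fibration-⊗ˡ (OC.p≡0⇒permutation c (others fzero λ ()))
               (fibration-onto-factor (c′ ∷ cs) j (λ i i≢j → others (fsuc i) (i≢j ∘ Fin.suc-injective)))

AtMostOneSourced : ∀ {m} → Vec OCycle (suc m) → Set
AtMostOneSourced {m} cs = ∀ (i j : Fin (suc m)) → Sourced (lookup cs i) → Sourced (lookup cs j) → i ≡ j

atMostOneSourced⇒others-sourceless : ∀ {m} (cs : Vec OCycle (suc m)) → AtMostOneSourced cs →
  ∀ j → Sourced (lookup cs j) → ∀ i → i ≢ j → p (lookup cs i) ≡ 0
atMostOneSourced⇒others-sourceless cs one j sj i i≢j =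
  decidable-stable (p (lookup cs i) ≟ 0) λ si → i≢j (one i j si sj)

ECD⇒atMostOneSourced : ∀ {m} (cs : Vec OCycle (suc m)) → IsECD (prodCycles cs) → AtMostOneSourced cs
ECD⇒atMostOneSourced cs ecd i j si sj = decidable-stable (i Fin.≟ j) λ i≢j →
  twinSources⇒¬ECD (two-sourced-factors⇒twinSources cs i j i≢j si sj) ecd

sourceless-ECD⇒even-factor : ∀ {m} (cs : Vec OCycle (suc m)) → Sourceless cs → IsECD (prodCycles cs) →
  ∃[ i ] (2 ∣ len (lookup cs i))
sourceless-ECD⇒even-factor cs none ecd with Fin.any? (λ i → 2 ∣? len (lookup cs i))
... | yes even = even
... | no ¬even with sourceless-odd-period cs none (λ i 2∣ → ¬even (i , 2∣))
...   | N , N-odd , period =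
  ⊥-elim (N-odd (PermutationDigraph.ECD⇒even-period (sourceless-permutation cs none) ecd period))

sourceless-even-factor⇒ECD : ∀ {m} (cs : Vec OCycle (suc m)) → Sourceless cs → ∀ i →
  2 ∣ len (lookup cs i) → IsECD (prodCycles cs)
sourceless-even-factor⇒ECD cs none i even = PermutationDigraph.alternating⇒ECD (sourceless-permutation cs none)
  (proj₂ (sourceless-even-factor⇒alternating cs none i even))

sourced-factor-ECD⇒sinksEven : ∀ {m} (cs : Vec OCycle (suc m)) → AtMostOneSourced cs → ∀ j →
  Sourced (lookup cs j) → IsECD (prodCycles cs) → SinksEvenToSource (lookup cs j)
sourced-factor-ECD⇒sinksEven cs one j sj (_ , ecd) =
  OC.ECD⇒sinksEven (lookup cs j) (fibration-onto-factor cs j (atMostOneSourced⇒others-sourceless cs one j sj))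
    ecd (proj₂ (OC.p≢0⇒source (lookup cs j) sj))

sourced-factor-sinksEven⇒ECD : ∀ {m} (cs : Vec OCycle (suc m)) → AtMostOneSourced cs → ∀ j →
  Sourced (lookup cs j) → SinksEvenToSource (lookup cs j) → IsECD (prodCycles cs)
sourced-factor-sinksEven⇒ECD cs one j sj sinks-even =
  ECD-pullback (OC.loopless (lookup cs j))
    (fibration-onto-factor cs j (atMostOneSourced⇒others-sourceless cs one j sj))
    (OC.Distance.sinksEven⇒ECD (lookup cs j) (proj₂ (OC.p≢0⇒source (lookup cs j) sj)) sinks-even)

theorem8 : (m : ℕ) (cs : Vec OCycle (suc m)) →
    IsECD (prodCycles cs) ⇔
      (((i j : Fin (suc m)) → p (lookup cs i) ≢ 0 → p (lookup cs j) ≢ 0 → i ≡ j) ×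
       (((i : Fin (suc m)) → p (lookup cs i) ≡ 0) → ∃[ i ] (2 ∣ len (lookup cs i))) ×
       ((j : Fin (suc m)) → p (lookup cs j) ≢ 0 → SinksEvenToSource (lookup cs j)))
theorem8 m cs = mk⇔
  (λ ecd → ECD⇒atMostOneSourced cs ecd , (λ none → sourceless-ECD⇒even-factor cs none ecd) ,
           (λ j sj → sourced-factor-ECD⇒sinksEven cs (ECD⇒atMostOneSourced cs ecd) j sj ecd))
  sufficient
  where
    sufficient : AtMostOneSourced cs × (Sourceless cs → ∃[ i ] (2 ∣ len (lookup cs i))) ×
                 (∀ j → Sourced (lookup cs j) → SinksEvenToSource (lookup cs j)) → IsECD (prodCycles cs)
    sufficient (one , even-factor , sinks-even) with Fin.any? (λ i → ¬? (p (lookup cs i) ≟ 0))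
    ... | yes (j , sj)  = sourced-factor-sinksEven⇒ECD cs one j sj (sinks-even j sj)
    ... | no  ¬sourced = let i , even = even-factor none in sourceless-even-factor⇒ECD cs none i even
      where
        none : Sourceless cs
        none i = decidable-stable (p (lookup cs i) ≟ 0) λ si → ¬sourced (i , si)
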